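{- Let $X$ be a permutation graph, let $\mathfrak{to}(X)$ and $\mathfrak{to}(\overline X)$ be the sets of transitive orientations of $X$ and of its complement $\overline X$, and let $\mathfrak{to}(X,\overline X)=\mathfrak{to}(X)\times\mathfrak{to}(\overline X)$. Then the action of ${\rm Aut}(X)$ on $\mathfrak{to}(X,\overline X)$, given by $\pi\cdot(\to,\overline{\to})=(\pi(\to),\pi(\overline{\to}))$, is semiregular, i.e., every element of $\mathfrak{to}(X,\overline X)$ has trivial stabilizer.
   Context: A transitive orientation of a graph is an orientation of its edges that is a transitive relation; a permutation graph is a graph $X$ such that both $X$ and $\overline X$ admit transitive orientations. For $\pi\in{\rm Aut}(X)$ (which is also an automorphism of $\overline X$) and a transitive orientation $\to$, the orientation $\pi(\to)$ is defined by: $x\to y$ implies $\pi(x)\mathrel{\pi(\to)}\pi(y)$; it is again a transitive orientation. -}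

module Defs where

open import Data.Nat using (ℕ)
open import Data.Fin using (Fin; _≟_)
open import Data.Fin.Permutation using (Permutation′; _⟨$⟩ʳ_)
open import Data.Bool using (Bool; true; false; not)
open import Data.Product using (_×_)
open import Data.Sum using (_⊎_)
open import Relation.Nullary using (yes; no)
open import Relation.Binary.PropositionalEquality using (_≡_)

record Graph (n : ℕ) : Set where
  field
    adj   : Fin n → Fin n → Bool
    adj-sym : ∀ x y → adj x y ≡ adj y x
    adj-irrefl : ∀ x → adj x x ≡ false
open Graph public

complAdj : ∀ {n} → (Fin n → Fin n → Bool) → Fin n → Fin n → Bool
complAdj E x y with x ≟ y
... | yes _ = false
... | no  _ = not (E x y)

complement : ∀ {n} → Graph n → Graph n
complement {n} G = record { adj = complAdj (adj G) ; adj-sym = s ; adj-irrefl = i }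
  where
  open import Relation.Binary.PropositionalEquality using (refl; cong)
  open import Relation.Nullary using (contradiction)
  open import Relation.Binary.PropositionalEquality using (sym)
  s : ∀ x y → complAdj (adj G) x y ≡ complAdj (adj G) y x
  s x y with x ≟ y | y ≟ x
  ... | yes _ | yes _ = refl
  ... | yes p | no q = contradiction (sym p) q
  ... | no p | yes q = contradiction (sym q) p
  ... | no _ | no _ = cong not (Graph.adj-sym G x y)
  i : ∀ x → complAdj (adj G) x x ≡ false
  i x with x ≟ x
  ... | yes _ = refl
  ... | no q = contradiction refl q

IsOrientation : ∀ {n} → Graph n → (Fin n → Fin n → Bool) → Set
IsOrientation G O =
    (∀ x y → O x y ≡ true → adj G x y ≡ true)
  × (∀ x y → adj G x y ≡ true → O x y ≡ true ⊎ O y x ≡ true)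
  × (∀ x y → O x y ≡ true → O y x ≡ false)

IsTransitiveOrientation : ∀ {n} → Graph n → (Fin n → Fin n → Bool) → Set
IsTransitiveOrientation G O =
    IsOrientation G O
  × (∀ x y z → O x y ≡ true → O y z ≡ true → O x z ≡ true)

IsPermutationGraph : ∀ {n} → Graph n → Set
IsPermutationGraph {n} G =
  Data.Product.Σ (Fin n → Fin n → Bool) (IsTransitiveOrientation G)
  × Data.Product.Σ (Fin n → Fin n → Bool) (IsTransitiveOrientation (complement G))
  where import Data.Product

IsAutomorphism : ∀ {n} → Graph n → Permutation′ n → Set
IsAutomorphism G π = ∀ x y → adj G (π ⟨$⟩ʳ x) (π ⟨$⟩ʳ y) ≡ adj G x y

-- π(O) = O.  Since π(O)(π x, π y) = O(x, y), this says O(π x, π y) = O(x, y).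
FixesOrientation : ∀ {n} → Permutation′ n → (Fin n → Fin n → Bool) → Set
FixesOrientation π O = ∀ x y → O (π ⟨$⟩ʳ x) (π ⟨$⟩ʳ y) ≡ O x y

module Submission where

-- A transitive orientation is a strict order (irreflexive and
-- transitive).  If an endofunction f of the finite set Fin n preserves a
-- strict order R and x R f(x), then the orbit x, f x, f² x, … is strictly
-- R-ascending; by the pigeonhole principle two of its first n+1 points
-- coincide, contradicting irreflexivity.  Hence an automorphism π fixing a
-- transitive orientation of a graph G never maps a vertex x to a neighbour
-- of x in G (apply the argument to the orientation or to its reverse,
-- whichever orients the edge x — π x from x).  Finally, a vertex moved by π
-- is a neighbour of its image either in X or in the complement of X, so
-- fixing a transitive orientation of both forces π to fix every vertex.

open import Defs
open import Data.Nat using (ℕ; zero; suc; s≤s; _<_)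
open import Data.Nat.Properties using (m≤n⇒m<n∨m≡n; n<1+n)
open import Data.Fin using (Fin; toℕ; _≟_)
open import Data.Fin.Properties using (pigeonhole)
open import Data.Fin.Permutation using (Permutation′; _⟨$⟩ʳ_)
open import Data.Bool using (Bool; true; false)
open import Data.Product using (_,_; ∃; uncurry)
open import Data.Sum using (_⊎_; inj₁; inj₂; [_,_])
open import Function using (flip)
open import Relation.Nullary using (¬_; yes; no; contradiction)
open import Relation.Binary.PropositionalEquality
  using (_≡_; _≢_; refl; sym; trans; cong; subst)

BRel : ℕ → Set
BRel n = Fin n → Fin n → Bool

record IsStrictOrderᵇ {n} (R : BRel n) : Set where
  field
    irreflexive : ∀ a → ¬ R a a ≡ true
    transitive  : ∀ a b c → R a b ≡ true → R b c ≡ true → R a c ≡ true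

Invariant : ∀ {n} → (Fin n → Fin n) → BRel n → Set
Invariant f R = ∀ a b → R (f a) (f b) ≡ R a b

iterate : ∀ {n} → (Fin n → Fin n) → ℕ → Fin n → Fin n
iterate f zero    x = x
iterate f (suc k) x = f (iterate f k x)

iterate-commute : ∀ {n} (f : Fin n → Fin n) k x →
                  iterate f k (f x) ≡ f (iterate f k x)
iterate-commute f zero    x = refl
iterate-commute f (suc k) x = cong f (iterate-commute f k x)

module _ {n} (f : Fin n → Fin n) (R : BRel n)
         (invariant : Invariant f R) (strict : IsStrictOrderᵇ R) where
  open IsStrictOrderᵇ strict

  iterate-invariant : ∀ k a b → R (iterate f k a) (iterate f k b) ≡ R a b
  iterate-invariant zero    a b = refl
  iterate-invariant (suc k) a b = trans (invariant _ _) (iterate-invariant k a b)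

  no-ascending-point : ∀ x → ¬ R x (f x) ≡ true
  no-ascending-point x x<fx = uncurry irreflexive repeated-point-ascends
    where
    orbit-step : ∀ k → R (iterate f k x) (iterate f (suc k) x) ≡ true
    orbit-step k =
      trans (cong (R (iterate f k x)) (sym (iterate-commute f k x)))
            (trans (iterate-invariant k x (f x)) x<fx)

    orbit-ascending : ∀ {i j} → i < j →
                      R (iterate f i x) (iterate f j x) ≡ true
    orbit-ascending {i} {suc j} (s≤s i≤j) with m≤n⇒m<n∨m≡n i≤j
    ... | inj₁ i<j  = transitive _ _ _ (orbit-ascending i<j) (orbit-step j)
    ... | inj₂ refl = orbit-step i

    -- Among the first n+1 orbit points two coincide.
    repeated-point-ascends : ∃ λ z → R z z ≡ true
    repeated-point-ascends
      with i , j , i<j , same ← pigeonhole (n<1+n n) (λ k → iterate f (toℕ k) x)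
      = iterate f (toℕ i) x
      , subst (λ z → R (iterate f (toℕ i) x) z ≡ true) (sym same)
              (orbit-ascending i<j)

transitive-orientation-strict : ∀ {n} (G : Graph n) (O : BRel n) →
  IsTransitiveOrientation G O → IsStrictOrderᵇ O
transitive-orientation-strict G O ((oriented-edge , _ , _) , trans-O) = record
  { irreflexive = λ a Oaa → true≢false (trans (sym (oriented-edge a a Oaa)) (adj-irrefl G a))
  ; transitive  = trans-O
  }
  where
  true≢false : true ≢ false
  true≢false ()

reverse-strict : ∀ {n} {R : BRel n} → IsStrictOrderᵇ R → IsStrictOrderᵇ (flip R)
reverse-strict s = record
  { irreflexive = irreflexive
  ; transitive  = λ a b c Rba Rcb → transitive c b a Rcb Rba
  }
  where open IsStrictOrderᵇ s

-- A map fixing a transitive orientation of G never sends a vertex to one of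
-- its neighbours: whichever way the edge x — f x is oriented, x would be an
-- ascending point of the orientation or of its reverse.
fixed-orientation-no-edge-to-image : ∀ {n} (G : Graph n) (f : Fin n → Fin n)
  (O : BRel n) → IsTransitiveOrientation G O → Invariant f O →
  ∀ x → ¬ adj G x (f x) ≡ true
fixed-orientation-no-edge-to-image G f O tO@((_ , covers , _) , _) invariant x edge =
  [ no-ascending-point f O invariant strict x
  , no-ascending-point f (flip O) (flip invariant) (reverse-strict strict) x
  ] (covers x (f x) edge)
  where
  strict : IsStrictOrderᵇ O
  strict = transitive-orientation-strict G O tO

adjacent-or-complement-adjacent : ∀ {n} (G : Graph n) {x y : Fin n} → x ≢ y →
  adj G x y ≡ true ⊎ adj (complement G) x y ≡ true
adjacent-or-complement-adjacent G {x} {y} x≢y with x ≟ y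
... | yes x≡y = contradiction x≡y x≢y
... | no _ with adj G x y
...   | true  = inj₁ refl
...   | false = inj₂ refl

-- A moved vertex x would be adjacent to π x in X or in its complement, which
-- the fixed orientation O, respectively Ō, rules out.
mainTheorem4 : ∀ {n} (X : Graph n) → IsPermutationGraph X →
    (π : Permutation′ n) → IsAutomorphism X π →
    (O : Fin n → Fin n → Bool) → IsTransitiveOrientation X O →
    (Ō : Fin n → Fin n → Bool) → IsTransitiveOrientation (complement X) Ō →
    FixesOrientation π O → FixesOrientation π Ō →
    ∀ x → π ⟨$⟩ʳ x ≡ x
mainTheorem4 X _ π _ O tO Ō tŌ fixes-O fixes-Ō x with π ⟨$⟩ʳ x ≟ x
... | yes fixed = fixed
... | no moved with adjacent-or-complement-adjacent X (λ x≡πx → moved (sym x≡πx))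
...   | inj₁ edge =
          contradiction edge (fixed-orientation-no-edge-to-image X _ O tO fixes-O x)
...   | inj₂ co-edge =
          contradiction co-edge
            (fixed-orientation-no-edge-to-image (complement X) _ Ō tŌ fixes-Ō x)
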